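{- For every cubic bridgeless graph $G$, $m_2(G)\ge \tfrac12\, m_3(G)+\tfrac16$.
   Context: A cubic bridgeless graph is a graph in which every vertex has degree 3 and each connected component is 2-edge-connected. A perfect matching of $G$ is a set of edges such that every vertex is incident to exactly one of them. For a cubic bridgeless graph $G$ and a positive integer $t$, $m_t(G)$ denotes the maximum, over all choices of $t$ perfect matchings $M_1,\dots,M_t$ of $G$, of $|M_1\cup\dots\cup M_t|/|E(G)|$. -}

module Defs where

open import Data.Nat using (ℕ; zero; suc; _+_; NonZero)
open import Data.Bool using (Bool; true; false; _∧_; _∨_; if_then_else_)
open import Data.Fin using (Fin; zero; suc; _≟_)
open import Data.Product using (_×_; _,_; proj₁; proj₂; Σ; ∃)
open import Data.Sum using (_⊎_)
open import Data.Integer using (+_)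
open import Data.Rational using (ℚ; _/_; _≤_)
open import Relation.Nullary.Decidable using (⌊_⌋)
open import Relation.Binary.PropositionalEquality using (_≡_; _≢_)

-- Finite (multi)graph: vertices Fin n, edges Fin m, each edge has two
-- distinct end vertices.  Parallel edges are allowed; loops are not.
record Graph : Set where
  field
    n    : ℕ
    m    : ℕ
    ends : Fin m → Fin n × Fin n
    noLoop : ∀ e → proj₁ (ends e) ≢ proj₂ (ends e)

open Graph public

count : {k : ℕ} → (Fin k → Bool) → ℕ
count {zero}  p = 0
count {suc k} p = (if p zero then 1 else 0) + count (λ i → p (suc i))

anyFin : {k : ℕ} → (Fin k → Bool) → Bool
anyFin {zero}  p = false
anyFin {suc k} p = p zero ∨ anyFin (λ i → p (suc i))

incident : (G : Graph) → Fin (m G) → Fin (n G) → Bool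
incident G e v = ⌊ proj₁ (ends G e) ≟ v ⌋ ∨ ⌊ proj₂ (ends G e) ≟ v ⌋

degree : (G : Graph) → Fin (n G) → ℕ
degree G v = count (λ e → incident G e v)

Cubic : Graph → Set
Cubic G = ∀ v → degree G v ≡ 3

Joins : (G : Graph) → Fin (m G) → Fin (n G) → Fin (n G) → Set
Joins G f x y = (ends G f ≡ (x , y)) ⊎ (ends G f ≡ (y , x))

data ReachAvoiding (G : Graph) (e : Fin (m G)) (u : Fin (n G)) : Fin (n G) → Set where
  here : ReachAvoiding G e u u
  step : ∀ {x y} (f : Fin (m G)) → f ≢ e → Joins G f x y →
         ReachAvoiding G e u x → ReachAvoiding G e u y

-- e is a bridge iff its ends are disconnected in G - e.
-- Bridgeless (every component 2-edge-connected) = no edge is a bridge.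
Bridgeless : Graph → Set
Bridgeless G = ∀ e → ReachAvoiding G e (proj₁ (ends G e)) (proj₂ (ends G e))

EdgeSet : Graph → Set
EdgeSet G = Fin (m G) → Bool

PerfectMatching : (G : Graph) → EdgeSet G → Set
PerfectMatching G M = ∀ v → count (λ e → M e ∧ incident G e v) ≡ 1

unionSize : (G : Graph) {t : ℕ} → (Fin t → EdgeSet G) → ℕ
unionSize G Ms = count (λ e → anyFin (λ i → Ms i e))

coverRatio : (G : Graph) → .{{_ : NonZero (m G)}} → {t : ℕ} → (Fin t → EdgeSet G) → ℚ
coverRatio G Ms = (+ unionSize G Ms) / m G

IsM : (G : Graph) → .{{_ : NonZero (m G)}} → (t : ℕ) → ℚ → Set
IsM G t r =
  (Σ (Fin t → EdgeSet G) λ Ms → (∀ i → PerfectMatching G (Ms i)) × coverRatio G Ms ≡ r)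
  × (∀ (Ms : Fin t → EdgeSet G) → (∀ i → PerfectMatching G (Ms i)) → coverRatio G Ms ≤ r)

module Submission where

-- Take three perfect matchings A, B, C attaining m₃(G), covering u
-- edges.  In a cubic graph every perfect matching has exactly m/3 edges
-- (double counting edge–vertex incidences), so |A| + |B| + |C| = m.  For a
-- single edge, with [X] its indicator of membership in X, one checks the
-- eight cases of
--     3·[A ∪ B ∪ C] + [A] + [B] + [C] ≤ 2·([A ∪ B] + [A ∪ C] + [B ∪ C]);
-- summing over all edges gives 3u + m ≤ 2·(|A ∪ B| + |A ∪ C| + |B ∪ C|).
-- Hence the best of the three pairs covers at least (3u + m)/6 edges, i.e.
-- its cover ratio is at least ½·(u/m) + 1/6, and m₂(G) is at least that.
-- Bridgelessness is only needed for the perfect matchings to exist; here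
-- they are given.

open import Defs
open import Data.Nat using (NonZero)
open import Data.Integer using (+_)
open import Data.Rational using (ℚ; _/_; _≤_; _+_; _*_; ½; toℚᵘ)

import Data.Nat as ℕ
open ℕ using (ℕ; zero; suc; z≤n; _⊔_)
import Data.Nat.Properties as ℕP
import Data.Integer as ℤ
import Data.Integer.Properties as ℤP
import Data.Rational.Properties as ℚP
import Data.Rational.Unnormalised as ℚᵘ
import Data.Rational.Unnormalised.Properties as ℚᵘP
open import Data.Bool using (Bool; true; false; _∧_; _∨_; if_then_else_)
open import Data.Bool.Properties using (∨-identityʳ)
open import Data.Fin using (Fin; zero; suc)
open import Data.Fin.Properties using (_≟_)
open import Data.Product using (_×_; _,_; proj₁; proj₂; Σ)
import Data.Sum as Sum
open Sum using (_⊎_; inj₁; inj₂)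
open import Data.Empty using (⊥; ⊥-elim)
open import Relation.Nullary using (yes; no; Dec)
open import Relation.Nullary.Decidable using (⌊_⌋)
open import Relation.Binary.PropositionalEquality
open import Algebra.Properties.Semiring.Sum ℕP.+-*-semiring
  using (sum; sum-cong-≗; ∑-distrib-+; ∑-comm; *-distribˡ-sum; *-distribʳ-sum)
open import Data.Nat.Solver using (module +-*-Solver)
open +-*-Solver using (solve; _:=_; _:+_; _:*_; con)

indicator : Bool → ℕ
indicator b = if b then 1 else 0

count≡sum : {k : ℕ} (p : Fin k → Bool) → count p ≡ sum (λ i → indicator (p i))
count≡sum {zero}  p = refl
count≡sum {suc k} p = cong (indicator (p zero) ℕ.+_) (count≡sum (λ i → p (suc i)))

count-cong : {k : ℕ} {p q : Fin k → Bool} → (∀ i → p i ≡ q i) → count p ≡ count q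
count-cong {zero}  eq = refl
count-cong {suc k} eq = cong₂ (λ b c → indicator b ℕ.+ c) (eq zero) (count-cong (λ i → eq (suc i)))

count-all : {k : ℕ} → count {k} (λ _ → true) ≡ k
count-all {zero}  = refl
count-all {suc k} = cong suc (count-all {k})

sum-const : {k : ℕ} (c : ℕ) → sum {k} (λ _ → c) ≡ k ℕ.* c
sum-const {zero}  c = refl
sum-const {suc k} c = cong (c ℕ.+_) (sum-const {k} c)

indicator-∧ : ∀ x y → indicator (x ∧ y) ≡ indicator x ℕ.* indicator y
indicator-∧ true  y = sym (ℕP.*-identityˡ (indicator y))
indicator-∧ false y = refl

indicator-∨-exclusive : {P Q : Set} (p? : Dec P) (q? : Dec Q) → (P → Q → ⊥) →
  indicator (⌊ p? ⌋ ∨ ⌊ q? ⌋) ≡ indicator ⌊ p? ⌋ ℕ.+ indicator ⌊ q? ⌋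
indicator-∨-exclusive (yes p) (yes q) exclusive = ⊥-elim (exclusive p q)
indicator-∨-exclusive (yes p) (no _)  exclusive = refl
indicator-∨-exclusive (no _)  q?      exclusive = refl

isYes-suc≟suc : {k : ℕ} (a v : Fin k) → ⌊ suc a ≟ suc v ⌋ ≡ ⌊ a ≟ v ⌋
isYes-suc≟suc a v with a ≟ v
... | yes _ = refl
... | no  _ = refl

sum-point : {k : ℕ} (a : Fin k) → sum (λ v → indicator ⌊ a ≟ v ⌋) ≡ 1
sum-point {suc k} zero    = cong suc (trans (sum-const {k} 0) (ℕP.*-zeroʳ k))
sum-point {suc k} (suc a) =
  trans (sum-cong-≗ (λ v → cong indicator (isYes-suc≟suc a v))) (sum-point a)

module _ (G : Graph) where

  -- Every edge has exactly two end vertices (they differ: no loops).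
  ends-count : (e : Fin (m G)) → sum (λ v → indicator (incident G e v)) ≡ 2
  ends-count e = begin
    sum (λ v → indicator (⌊ x ≟ v ⌋ ∨ ⌊ y ≟ v ⌋))
      ≡⟨ sum-cong-≗ (λ v → indicator-∨-exclusive (x ≟ v) (y ≟ v) (λ x≡v y≡v → noLoop G e (trans x≡v (sym y≡v)))) ⟩
    sum (λ v → indicator ⌊ x ≟ v ⌋ ℕ.+ indicator ⌊ y ≟ v ⌋)
      ≡⟨ ∑-distrib-+ (λ v → indicator ⌊ x ≟ v ⌋) (λ v → indicator ⌊ y ≟ v ⌋) ⟩
    sum (λ v → indicator ⌊ x ≟ v ⌋) ℕ.+ sum (λ v → indicator ⌊ y ≟ v ⌋)
      ≡⟨ cong₂ ℕ._+_ (sum-point x) (sum-point y) ⟩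
    2 ∎
    where
    open ≡-Reasoning
    x = proj₁ (ends G e)
    y = proj₂ (ends G e)

  handshake : (S : EdgeSet G) → sum (λ v → count (λ e → S e ∧ incident G e v)) ≡ count S ℕ.* 2
  handshake S = begin
    sum (λ v → count (λ e → S e ∧ incident G e v))
      ≡⟨ sum-cong-≗ (λ v → count≡sum (λ e → S e ∧ incident G e v)) ⟩
    sum (λ v → sum (λ e → indicator (S e ∧ incident G e v)))
      ≡⟨ ∑-comm (λ v e → indicator (S e ∧ incident G e v)) ⟩
    sum (λ e → sum (λ v → indicator (S e ∧ incident G e v)))
      ≡⟨ sum-cong-≗ (λ e → sum-cong-≗ (λ v → indicator-∧ (S e) (incident G e v))) ⟩
    sum (λ e → sum (λ v → indicator (S e) ℕ.* indicator (incident G e v)))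
      ≡⟨ sum-cong-≗ (λ e → sym (*-distribˡ-sum (indicator (S e)) (λ v → indicator (incident G e v)))) ⟩
    sum (λ e → indicator (S e) ℕ.* sum (λ v → indicator (incident G e v)))
      ≡⟨ sum-cong-≗ (λ e → cong (indicator (S e) ℕ.*_) (ends-count e)) ⟩
    sum (λ e → indicator (S e) ℕ.* 2)
      ≡⟨ sym (*-distribʳ-sum 2 (λ e → indicator (S e))) ⟩
    sum (λ e → indicator (S e)) ℕ.* 2
      ≡⟨ cong (ℕ._* 2) (sym (count≡sum S)) ⟩
    count S ℕ.* 2 ∎
    where open ≡-Reasoning

  cubic-edges : Cubic G → m G ℕ.* 2 ≡ n G ℕ.* 3
  cubic-edges cubic = begin
    m G ℕ.* 2                       ≡⟨ cong (ℕ._* 2) (sym (count-all {m G})) ⟩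
    count {m G} (λ _ → true) ℕ.* 2  ≡⟨ sym (handshake (λ _ → true)) ⟩
    sum {n G} (degree G)            ≡⟨ sum-cong-≗ cubic ⟩
    sum {n G} (λ _ → 3)             ≡⟨ sum-const {n G} 3 ⟩
    n G ℕ.* 3 ∎
    where open ≡-Reasoning

  perfectMatching-size : (M : EdgeSet G) → PerfectMatching G M → count M ℕ.* 2 ≡ n G
  perfectMatching-size M perfect = begin
    count M ℕ.* 2                                  ≡⟨ sym (handshake M) ⟩
    sum (λ v → count (λ e → M e ∧ incident G e v)) ≡⟨ sum-cong-≗ perfect ⟩
    sum {n G} (λ _ → 1)                            ≡⟨ sum-const {n G} 1 ⟩
    n G ℕ.* 1                                      ≡⟨ ℕP.*-identityʳ (n G) ⟩
    n G ∎
    where open ≡-Reasoning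

  perfectMatching-third : Cubic G → (M : EdgeSet G) → PerfectMatching G M → count M ℕ.* 3 ≡ m G
  perfectMatching-third cubic M perfect = ℕP.*-cancelʳ-≡ (count M ℕ.* 3) (m G) 2 (begin
    count M ℕ.* 3 ℕ.* 2  ≡⟨ solve 1 (λ c → c :* con 3 :* con 2 := c :* con 2 :* con 3) refl (count M) ⟩
    count M ℕ.* 2 ℕ.* 3  ≡⟨ cong (ℕ._* 3) (perfectMatching-size M perfect) ⟩
    n G ℕ.* 3            ≡⟨ sym (cubic-edges cubic) ⟩
    m G ℕ.* 2 ∎)
    where open ≡-Reasoning

element-inequality : ∀ a b c →
  3 ℕ.* indicator (a ∨ b ∨ c) ℕ.+ (indicator a ℕ.+ indicator b ℕ.+ indicator c)
    ℕ.≤ 2 ℕ.* (indicator (a ∨ b) ℕ.+ indicator (a ∨ c) ℕ.+ indicator (b ∨ c))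
element-inequality true  true  true  = ℕP.≤ᵇ⇒≤ 6 6 _
element-inequality true  true  false = ℕP.≤ᵇ⇒≤ 5 6 _
element-inequality true  false true  = ℕP.≤ᵇ⇒≤ 5 6 _
element-inequality true  false false = ℕP.≤ᵇ⇒≤ 4 4 _
element-inequality false true  true  = ℕP.≤ᵇ⇒≤ 5 6 _
element-inequality false true  false = ℕP.≤ᵇ⇒≤ 4 4 _
element-inequality false false true  = ℕP.≤ᵇ⇒≤ 4 4 _
element-inequality false false false = z≤n

three-sets-inequality : {k : ℕ} (A B C : Fin k → Bool) →
  3 ℕ.* count (λ e → A e ∨ B e ∨ C e) ℕ.+ (count A ℕ.+ count B ℕ.+ count C)
    ℕ.≤ 2 ℕ.* (count (λ e → A e ∨ B e) ℕ.+ count (λ e → A e ∨ C e) ℕ.+ count (λ e → B e ∨ C e))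
three-sets-inequality {zero}  A B C = z≤n
three-sets-inequality {suc k} A B C =
  subst₂ ℕ._≤_ (regroup-left u₀ a₀ b₀ c₀ _ _ _ _) (regroup-right ab₀ ac₀ bc₀ _ _ _)
    (ℕP.+-mono-≤ (element-inequality (A zero) (B zero) (C zero))
                 (three-sets-inequality (λ e → A (suc e)) (λ e → B (suc e)) (λ e → C (suc e))))
  where
  u₀ = indicator (A zero ∨ B zero ∨ C zero)
  a₀ = indicator (A zero)
  b₀ = indicator (B zero)
  c₀ = indicator (C zero)
  ab₀ = indicator (A zero ∨ B zero)
  ac₀ = indicator (A zero ∨ C zero)
  bc₀ = indicator (B zero ∨ C zero)
  regroup-left : ∀ u a b c U A B C →
    3 ℕ.* u ℕ.+ (a ℕ.+ b ℕ.+ c) ℕ.+ (3 ℕ.* U ℕ.+ (A ℕ.+ B ℕ.+ C))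
      ≡ 3 ℕ.* (u ℕ.+ U) ℕ.+ ((a ℕ.+ A) ℕ.+ (b ℕ.+ B) ℕ.+ (c ℕ.+ C))
  regroup-left = solve 8 (λ u a b c U A B C →
    con 3 :* u :+ (a :+ b :+ c) :+ (con 3 :* U :+ (A :+ B :+ C))
      := con 3 :* (u :+ U) :+ ((a :+ A) :+ (b :+ B) :+ (c :+ C))) refl
  regroup-right : ∀ x y z X Y Z →
    2 ℕ.* (x ℕ.+ y ℕ.+ z) ℕ.+ 2 ℕ.* (X ℕ.+ Y ℕ.+ Z) ≡ 2 ℕ.* ((x ℕ.+ X) ℕ.+ (y ℕ.+ Y) ℕ.+ (z ℕ.+ Z))
  regroup-right = solve 6 (λ x y z X Y Z →
    con 2 :* (x :+ y :+ z) :+ con 2 :* (X :+ Y :+ Z) := con 2 :* ((x :+ X) :+ (y :+ Y) :+ (z :+ Z))) refl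

thirds-sum : ∀ a b c t → a ℕ.* 3 ≡ t → b ℕ.* 3 ≡ t → c ℕ.* 3 ≡ t → a ℕ.+ b ℕ.+ c ≡ t
thirds-sum a b c t refl b₃ c₃ = ℕP.*-cancelʳ-≡ (a ℕ.+ b ℕ.+ c) (a ℕ.* 3) 3 (begin
  (a ℕ.+ b ℕ.+ c) ℕ.* 3               ≡⟨ solve 3 (λ a b c → (a :+ b :+ c) :* con 3 := a :* con 3 :+ b :* con 3 :+ c :* con 3) refl a b c ⟩
  a ℕ.* 3 ℕ.+ b ℕ.* 3 ℕ.+ c ℕ.* 3     ≡⟨ cong₂ (λ x y → a ℕ.* 3 ℕ.+ x ℕ.+ y) b₃ c₃ ⟩
  a ℕ.* 3 ℕ.+ a ℕ.* 3 ℕ.+ a ℕ.* 3     ≡⟨ solve 1 (λ x → x :+ x :+ x := x :* con 3) refl (a ℕ.* 3) ⟩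
  a ℕ.* 3 ℕ.* 3 ∎)
  where open ≡-Reasoning

max-of-three : ∀ x y z → (x ⊔ y ⊔ z ≡ x) ⊎ (x ⊔ y ⊔ z ≡ y) ⊎ (x ⊔ y ⊔ z ≡ z)
max-of-three x y z with ℕP.⊔-sel (x ⊔ y) z | ℕP.⊔-sel x y
... | inj₂ w≡z  | _         = inj₂ (inj₂ w≡z)
... | inj₁ w≡xy | inj₁ xy≡x = inj₁ (trans w≡xy xy≡x)
... | inj₁ w≡xy | inj₂ xy≡y = inj₂ (inj₁ (trans w≡xy xy≡y))

sum≤3*max : ∀ x y z → x ℕ.+ y ℕ.+ z ℕ.≤ 3 ℕ.* (x ⊔ y ⊔ z)
sum≤3*max x y z = begin
  x ℕ.+ y ℕ.+ z  ≤⟨ ℕP.+-mono-≤ (ℕP.+-mono-≤ x≤w y≤w) z≤w ⟩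
  w ℕ.+ w ℕ.+ w  ≡⟨ solve 1 (λ w → w :+ w :+ w := con 3 :* w) refl w ⟩
  3 ℕ.* w ∎
  where
  open ℕP.≤-Reasoning
  w = x ⊔ y ⊔ z
  x≤w = ℕP.≤-trans (ℕP.m≤m⊔n x y) (ℕP.m≤m⊔n (x ⊔ y) z)
  y≤w = ℕP.≤-trans (ℕP.m≤n⊔m x y) (ℕP.m≤m⊔n (x ⊔ y) z)
  z≤w = ℕP.m≤n⊔m (x ⊔ y) z

best-of-three : ∀ t x y z → t ℕ.≤ 2 ℕ.* (x ℕ.+ y ℕ.+ z) →
  (t ℕ.≤ 6 ℕ.* x) ⊎ (t ℕ.≤ 6 ℕ.* y) ⊎ (t ℕ.≤ 6 ℕ.* z)
best-of-three t x y z t≤ =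
  Sum.map at-max (Sum.map at-max at-max) (max-of-three x y z)
  where
  t≤max : t ℕ.≤ 6 ℕ.* (x ⊔ y ⊔ z)
  t≤max = ℕP.≤-trans t≤ (ℕP.≤-trans (ℕP.*-monoʳ-≤ 2 (sum≤3*max x y z))
                                     (ℕP.≤-reflexive (sym (ℕP.*-assoc 2 3 (x ⊔ y ⊔ z)))))
  at-max : ∀ {v} → x ⊔ y ⊔ z ≡ v → t ℕ.≤ 6 ℕ.* v
  at-max eq = subst (λ w → t ℕ.≤ 6 ℕ.* w) eq t≤max

-- The arithmetic core of the ratio bound, for unnormalised fractions with
-- denominator c = suc k:  3u + c ≤ 6p  gives  ½·(u/c) + 1/6 ≤ p/c.
ratio-boundᵘ : ∀ u p k → 3 ℕ.* u ℕ.+ suc k ℕ.≤ 6 ℕ.* p →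
  ℚᵘ.mkℚᵘ (+ 1) 1 ℚᵘ.* ℚᵘ.mkℚᵘ (+ u) k ℚᵘ.+ ℚᵘ.mkℚᵘ (+ 1) 5 ℚᵘ.≤ ℚᵘ.mkℚᵘ (+ p) k
ratio-boundᵘ u p k h = ℚᵘ.*≤* (subst₂ ℤ._≤_ lhs-cast rhs-cast (ℤ.+≤+ cross-multiplied))
  where
  c = suc k
  cross-multiplied : ((1 ℕ.* u) ℕ.* 6 ℕ.+ 1 ℕ.* (2 ℕ.* c)) ℕ.* c ℕ.≤ p ℕ.* (2 ℕ.* c ℕ.* 6)
  cross-multiplied = subst₂ ℕ._≤_
    (solve 2 (λ u c → (con 3 :* u :+ c) :* (con 2 :* c) := ((con 1 :* u) :* con 6 :+ con 1 :* (con 2 :* c)) :* c) refl u c)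
    (solve 2 (λ p c → con 6 :* p :* (con 2 :* c) := p :* (con 2 :* c :* con 6)) refl p c)
    (ℕP.*-monoˡ-≤ (2 ℕ.* c) h)
  lhs-cast : + (((1 ℕ.* u) ℕ.* 6 ℕ.+ 1 ℕ.* (2 ℕ.* c)) ℕ.* c)
           ≡ ((+ 1 ℤ.* + u) ℤ.* + 6 ℤ.+ + 1 ℤ.* + (2 ℕ.* c)) ℤ.* + c
  lhs-cast = trans (ℤP.pos-* ((1 ℕ.* u) ℕ.* 6 ℕ.+ 1 ℕ.* (2 ℕ.* c)) c) (cong (ℤ._* + c)
    (cong₂ ℤ._+_ (trans (ℤP.pos-* (1 ℕ.* u) 6) (cong (ℤ._* + 6) (ℤP.pos-* 1 u)))
                 (ℤP.pos-* 1 (2 ℕ.* c))))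
  rhs-cast : + (p ℕ.* (2 ℕ.* c ℕ.* 6)) ≡ + p ℤ.* + (2 ℕ.* c ℕ.* 6)
  rhs-cast = ℤP.pos-* p _

ratio-bound : ∀ u p d .{{_ : NonZero d}} → 3 ℕ.* u ℕ.+ d ℕ.≤ 6 ℕ.* p →
  ½ * ((+ u) / d) + (+ 1) / 6 ≤ (+ p) / d
ratio-bound u p (suc k) h = ℚP.toℚᵘ-cancel-≤
  (ℚᵘP.≤-respʳ-≃ (ℚᵘP.≃-sym (ℚP.toℚᵘ-fromℚᵘ (ℚᵘ.mkℚᵘ (+ p) k)))
  (ℚᵘP.≤-respˡ-≃ (ℚᵘP.≃-sym lhs≃) (ratio-boundᵘ u p k h)))
  where
  lhs≃ : toℚᵘ (½ * ((+ u) / suc k) + (+ 1) / 6)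
           ℚᵘ.≃ ℚᵘ.mkℚᵘ (+ 1) 1 ℚᵘ.* ℚᵘ.mkℚᵘ (+ u) k ℚᵘ.+ ℚᵘ.mkℚᵘ (+ 1) 5
  lhs≃ = ℚᵘP.≃-trans (ℚP.toℚᵘ-homo-+ (½ * ((+ u) / suc k)) ((+ 1) / 6))
    (ℚᵘP.+-cong (ℚᵘP.≃-trans (ℚP.toℚᵘ-homo-* ½ ((+ u) / suc k))
                             (ℚᵘP.*-cong ℚᵘP.≃-refl (ℚP.toℚᵘ-fromℚᵘ (ℚᵘ.mkℚᵘ (+ u) k))))
                (ℚP.toℚᵘ-fromℚᵘ (ℚᵘ.mkℚᵘ (+ 1) 5)))

module _ (G : Graph) where

  pair : EdgeSet G → EdgeSet G → Fin 2 → EdgeSet G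
  pair X Y zero    = X
  pair X Y (suc _) = Y

  pair-perfect : ∀ {X Y} → PerfectMatching G X → PerfectMatching G Y →
                 ∀ i → PerfectMatching G (pair X Y i)
  pair-perfect perfect-X perfect-Y zero    = perfect-X
  pair-perfect perfect-X perfect-Y (suc _) = perfect-Y

  -- The union sizes of pairs and triples, without the trailing '∨ false'.
  unionSize-pair : (X Y : EdgeSet G) → unionSize G (pair X Y) ≡ count (λ e → X e ∨ Y e)
  unionSize-pair X Y = count-cong (λ e → cong (X e ∨_) (∨-identityʳ (Y e)))

  unionSize-triple : (Ms : Fin 3 → EdgeSet G) →
    unionSize G Ms ≡ count (λ e → Ms zero e ∨ Ms (suc zero) e ∨ Ms (suc (suc zero)) e)
  unionSize-triple Ms = count-cong (λ e → cong (λ b → Ms zero e ∨ Ms (suc zero) e ∨ b)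
                                               (∨-identityʳ (Ms (suc (suc zero)) e)))

  best-pair : Cubic G → (Ms : Fin 3 → EdgeSet G) → (∀ i → PerfectMatching G (Ms i)) →
    Σ (Fin 2 → EdgeSet G) λ Ns → (∀ i → PerfectMatching G (Ns i))
                                 × 3 ℕ.* unionSize G Ms ℕ.+ m G ℕ.≤ 6 ℕ.* unionSize G Ns
  best-pair cubic Ms perfect =
    Sum.[ candidate (perfect zero) (perfect (suc zero))
        , Sum.[ candidate (perfect zero) (perfect (suc (suc zero)))
              , candidate (perfect (suc zero)) (perfect (suc (suc zero))) ]′ ]′
      (best-of-three _ (unionSize G (pair A B)) (unionSize G (pair A C)) (unionSize G (pair B C))
                     union-bound)
    where
    A = Ms zero
    B = Ms (suc zero)
    C = Ms (suc (suc zero))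
    sizes : count A ℕ.+ count B ℕ.+ count C ≡ m G
    sizes = thirds-sum (count A) (count B) (count C) (m G)
      (perfectMatching-third G cubic A (perfect zero))
      (perfectMatching-third G cubic B (perfect (suc zero)))
      (perfectMatching-third G cubic C (perfect (suc (suc zero))))
    union-bound : 3 ℕ.* unionSize G Ms ℕ.+ m G
      ℕ.≤ 2 ℕ.* (unionSize G (pair A B) ℕ.+ unionSize G (pair A C) ℕ.+ unionSize G (pair B C))
    union-bound = subst₂ ℕ._≤_
      (cong₂ (λ u s → 3 ℕ.* u ℕ.+ s) (sym (unionSize-triple Ms)) sizes)
      (cong (2 ℕ.*_) (sym (cong₂ ℕ._+_ (cong₂ ℕ._+_ (unionSize-pair A B) (unionSize-pair A C))
                                       (unionSize-pair B C))))
      (three-sets-inequality A B C)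
    candidate : ∀ {X Y} → PerfectMatching G X → PerfectMatching G Y →
      3 ℕ.* unionSize G Ms ℕ.+ m G ℕ.≤ 6 ℕ.* unionSize G (pair X Y) →
      Σ (Fin 2 → EdgeSet G) λ Ns → (∀ i → PerfectMatching G (Ns i))
                                   × 3 ℕ.* unionSize G Ms ℕ.+ m G ℕ.≤ 6 ℕ.* unionSize G Ns
    candidate {X} {Y} perfect-X perfect-Y covers = pair X Y , pair-perfect perfect-X perfect-Y , covers

theorem10 : (G : Graph) → Cubic G → Bridgeless G → .{{_ : NonZero (m G)}} →
            (r₂ r₃ : ℚ) → IsM G 2 r₂ → IsM G 3 r₃ →
            ½ * r₃ + (+ 1) / 6 ≤ r₂
theorem10 G cubic _ r₂ r₃ (_ , r₂-maximal) ((Ms , perfect , ratio≡r₃) , _)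
  with best-pair G cubic Ms perfect
... | Ns , perfect-Ns , covers =
  subst (λ r → ½ * r + (+ 1) / 6 ≤ r₂) ratio≡r₃
    (ℚP.≤-trans (ratio-bound (unionSize G Ms) (unionSize G Ns) (m G) covers)
                (r₂-maximal Ns perfect-Ns))
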